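{- Let $L$ be a mathematically agreeable language and let $\mathcal L$, $D$, $G$, $F$ be as in the context. Let $U\subseteq D$ be consistent with $U=G(U)$, and let $A$ be a sentence of $L$. Then $A$ is either true or false in the interpretation of $L$, and: (a) $A$ is true in the interpretation of $L$ iff $\#A\in G(U)$ iff $\#T(\lceil A\rceil)\in G(U)$; (b) $A$ is false in the interpretation of $L$ iff $\#A\in F(U)$ iff $\#T(\lceil A\rceil)\in F(U)$.
   Context: A language $L$ is mathematically agreeable (MA) if: it contains a countable syntax of first-order predicate logic with equality, with natural numbers and their names (numerals) as terms; it is fully interpreted, i.e. each sentence of $L$ is interpreted either as true or as false (not both); classical truth tables hold for $\neg,\vee,\wedge,\rightarrow,\leftrightarrow$ and classical truth rules hold for $\forall,\exists$. Let $T$ be a monadic predicate whose domain of discourse is the set of numerals. Let $\mathcal L$ be the language whose basic sentences are the sentences of $L$, the sentences $T(\mathbf n)$ for numerals $\mathbf n$, $\forall xT(x)$ and $\exists xT(x)$, and which is closed under $\neg,\vee,\wedge,\rightarrow,\leftrightarrow$. Fix a Gödel numbering of sentences of $\mathcal L$; $\#A$ denotes the Gödel number of $A$, $\lceil A\rceil$ the numeral of $\#A$, and $D$ the set of Gödel numbers of sentences of $\mathcal L$. For $U\subseteq D$, the sets $G(U),F(U)\subseteq D$ are determined (by induction on complexity of sentences) by the rules: (r1) for a sentence $A$ of $L$, $\#A\in G(U)$ iff $A$ is true in the interpretation of $L$, and $\#A\in F(U)$ iff $A$ is false in it; (r2) for a numeral $\mathbf n$, $\#T(\mathbf n)\in G(U)$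 iff $\mathbf n=\lceil A\rceil$ for a sentence $A$ of $\mathcal L$ with $\#A\in U$, and $\#T(\mathbf n)\in F(U)$ iff $\mathbf n=\lceil A\rceil$ for a sentence $A$ of $\mathcal L$ with $\#[\neg A]\in U$; (r3) $\#[\neg A]\in G(U)$ iff $\#A\in F(U)$, and $\#[\neg A]\in F(U)$ iff $\#A\in G(U)$; (r4) $\#[A\vee B]\in G(U)$ iff $\#A\in G(U)$ or $\#B\in G(U)$, and $\in F(U)$ iff both $\#A,\#B\in F(U)$; (r5) $\#[A\wedge B]\in G(U)$ iff both $\#A,\#B\in G(U)$, and $\in F(U)$ iff $\#A\in F(U)$ or $\#B\in F(U)$; (r6) $\#[A\rightarrow B]\in G(U)$ iff $\#A\in F(U)$ or $\#B\in G(U)$, and $\in F(U)$ iff $\#A\in G(U)$ and $\#B\in F(U)$; (r7) $\#[A\leftrightarrow B]\in G(U)$ iff $\#A,\#B$ are both in $G(U)$ or both in $F(U)$, and $\in F(U)$ iff one of $\#A,\#B$ is in $G(U)$ and the other in $F(U)$; (r8) $\#[\exists xT(x)]\in G(U)$ iff $\#T(\mathbf n)\in G(U)$ for some numeral $\mathbf n$, and $\in F(U)$ iff $\#T(\mathbf n)\in F(U)$ for every numeral $\mathbf n$; (r9) $\#[\forall xT(x)]\in G(U)$ iff $\#T(\mathbf n)\in G(U)$ for every numeral $\mathbf n$, and $\in F(U)$ iff $\#T(\mathbf n)\in F(U)$ for some numeral $\mathbf n$. A set $U\subseteq D$ is consistent if there is no sentence $A$ of $\mathcal L$ with both $\#A\in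 U$ and $\#[\neg A]\in U$. For such $U$ with $U=G(U)$, a sentence $A$ of $\mathcal L$ is called true iff $\#A\in G(U)$ and false iff $\#A\in F(U)$. -}

module Defs where

open import Data.Nat using (ℕ)
open import Data.Product using (Σ; _×_; ∃)
open import Data.Sum using (_⊎_)
open import Data.Empty using (⊥)
open import Relation.Nullary using (¬_)
open import Relation.Binary.PropositionalEquality using (_≡_)
open import Function.Definitions using (Injective)
open import Function.Bundles using (_⇔_)

-- A mathematically agreeable language L, abstracted to what the statement uses:
-- a type of sentences with a full interpretation: every sentence is true or
-- false, and never both.  (The internal first-order syntax of L is not needed:
-- sentences of L occur only as atomic building blocks of 𝓛.)
record MA : Set₁ where
  field
    SentL    : Set
    TrueL    : SentL → Set
    FalseL   : SentL → Set
    fullyInterpreted : ∀ A → TrueL A ⊎ FalseL A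
    notBoth  : ∀ A → ¬ (TrueL A × FalseL A)

-- Sentences of 𝓛 over a type S of sentences of L.
-- Numerals are identified with the natural numbers they name.
data Sent (S : Set) : Set where
  base  : S → Sent S
  T     : ℕ → Sent S
  allT  : Sent S
  exT   : Sent S
  ¬'_   : Sent S → Sent S
  _∨'_  : Sent S → Sent S → Sent S
  _∧'_  : Sent S → Sent S → Sent S
  _⇒'_  : Sent S → Sent S → Sent S
  _⇔'_  : Sent S → Sent S → Sent S

record GodelNumbering (S : Set) : Set where
  field
    #_    : Sent S → ℕ
    #-inj : Injective _≡_ _≡_ #_

module Semantics (L : MA) (g : GodelNumbering (MA.SentL L)) where
  open MA L
  open GodelNumbering g

  𝓢 : Set
  𝓢 = Sent SentL

  D : ℕ → Set
  D n = Σ 𝓢 λ A → # A ≡ n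

  _⊆_ : (ℕ → Set) → (ℕ → Set) → Set
  P ⊆ Q = ∀ n → P n → Q n

  _≐_ : (ℕ → Set) → (ℕ → Set) → Set
  P ≐ Q = ∀ n → P n ⇔ Q n

  module _ (U : ℕ → Set) where
    GT FT : ℕ → Set
    GT n = Σ 𝓢 λ A → (# A ≡ n) × U (# A)
    FT n = Σ 𝓢 λ A → (# A ≡ n) × U (# (¬' A))

    Gs Fs : 𝓢 → Set
    Gs (base A) = TrueL A
    Gs (T n)    = GT n
    Gs allT     = ∀ n → GT n
    Gs exT      = Σ ℕ GT
    Gs (¬' A)   = Fs A
    Gs (A ∨' B) = Gs A ⊎ Gs B
    Gs (A ∧' B) = Gs A × Gs B
    Gs (A ⇒' B) = Fs A ⊎ Gs B
    Gs (A ⇔' B) = (Gs A × Gs B) ⊎ (Fs A × Fs B)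
    Fs (base A) = FalseL A
    Fs (T n)    = FT n
    Fs allT     = Σ ℕ FT
    Fs exT      = ∀ n → FT n
    Fs (¬' A)   = Gs A
    Fs (A ∨' B) = Fs A × Fs B
    Fs (A ∧' B) = Fs A ⊎ Fs B
    Fs (A ⇒' B) = Gs A × Fs B
    Fs (A ⇔' B) = (Gs A × Fs B) ⊎ (Fs A × Gs B)

    G F : ℕ → Set
    G n = Σ 𝓢 λ A → (# A ≡ n) × Gs A
    F n = Σ 𝓢 λ A → (# A ≡ n) × Fs A

    Consistent : Set
    Consistent = ¬ (Σ 𝓢 λ A → U (# A) × U (# (¬' A)))

module Submission where

open import Defs
open import Data.Nat using (ℕ)
open import Data.Product using (_×_; _,_)
open import Data.Sum using (_⊎_)
open import Function.Bundles using (_⇔_; mk⇔)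
open import Function.Properties.Equivalence using () renaming (sym to ⇔-sym; trans to ⇔-trans)
open import Relation.Binary.PropositionalEquality using (_≡_; refl)

-- Every clause of r1–r9 is read off a sentence through its Gödel number, and
-- # is injective, so membership of # B in G(U), F(U) is just the clause for B.
-- At a fixed point U = G(U) the clause for T(⌜B⌝) (membership of # B, resp.
-- # ¬B, in U) is then again the clause for B: T is transparent.

module TruthTransparency (L : MA) (g : GodelNumbering (MA.SentL L)) where
  open MA L
  open GodelNumbering g
  open Semantics L g

  #-transport : (P : 𝓢 → Set) {B C : 𝓢} → # C ≡ # B → P C → P B
  #-transport P eq p with #-inj eq
  ... | refl = p

  module _ (U : ℕ → Set) where

    G-# : ∀ B → G U (# B) ⇔ Gs U B
    G-# B = mk⇔ (λ { (_ , eq , p) → #-transport (Gs U) eq p }) (λ p → B , refl , p)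

    F-# : ∀ B → F U (# B) ⇔ Fs U B
    F-# B = mk⇔ (λ { (_ , eq , p) → #-transport (Fs U) eq p }) (λ p → B , refl , p)

    GT-# : ∀ B → GT U (# B) ⇔ U (# B)
    GT-# B = mk⇔ (λ { (_ , eq , u) → #-transport (λ C → U (# C)) eq u }) (λ u → B , refl , u)

    FT-# : ∀ B → FT U (# B) ⇔ U (# (¬' B))
    FT-# B = mk⇔ (λ { (_ , eq , u) → #-transport (λ C → U (# (¬' C))) eq u }) (λ u → B , refl , u)

    module _ (fixed : U ≐ G U) where

      U-# : ∀ B → U (# B) ⇔ Gs U B
      U-# B = ⇔-trans (fixed (# B)) (G-# B)

      Gs-T : ∀ B → Gs U (T (# B)) ⇔ Gs U B
      Gs-T B = ⇔-trans (GT-# B) (U-# B)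

      Fs-T : ∀ B → Fs U (T (# B)) ⇔ Fs U B
      Fs-T B = ⇔-trans (FT-# B) (U-# (¬' B))

      G-T : ∀ B → G U (# B) ⇔ G U (# T (# B))
      G-T B = ⇔-trans (G-# B) (⇔-sym (⇔-trans (G-# (T (# B))) (Gs-T B)))

      F-T : ∀ B → F U (# B) ⇔ F U (# T (# B))
      F-T B = ⇔-trans (F-# B) (⇔-sym (⇔-trans (F-# (T (# B))) (Fs-T B)))

lemma4p2 : (L : MA) (g : GodelNumbering (MA.SentL L)) →
    let open MA L
        open GodelNumbering g
        open Semantics L g
    in (U : ℕ → Set) → U ⊆ D → Consistent U → U ≐ G U →
       (A : SentL) →
       (TrueL A ⊎ FalseL A)
       × ((TrueL A ⇔ G U (# base A)) × (G U (# base A) ⇔ G U (# T (# base A))))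
       × ((FalseL A ⇔ F U (# base A)) × (F U (# base A) ⇔ F U (# T (# base A))))
lemma4p2 L g U _ _ fixed A =
    fullyInterpreted A
  , (⇔-sym (G-# U (base A)) , G-T U fixed (base A))
  , (⇔-sym (F-# U (base A)) , F-T U fixed (base A))
  where
  open MA L
  open TruthTransparency L g
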